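{- Let $G$ be a formula. For a $\mathbf{GBU}(G)$-sequent $\tau$ with left-hand side $\Psi$ define $\mathrm{Wg}(\tau)=\langle |\mathrm{Sl}(G)\setminus\mathrm{Cl}(\Psi)|,\ \mathrm{tp}(\tau),\ |\tau|\rangle$, where $\mathrm{tp}(\tau)=1$ if $\tau$ is regular and $0$ if irregular, and $|\tau|$ is the number of logical symbols occurring in $\tau$. For every instance of a rule of $\mathbf{GBU}(G)$ with conclusion $\tau$ and any premise $\tau'$, $\langle0,0,0\rangle\preceq\mathrm{Wg}(\tau')\prec\mathrm{Wg}(\tau)$, where $\prec$ is the lexicographic order on triples of integers.
   Context: Formulas are built from a countably infinite set of propositional variables and $\bot$ using $\land,\lor,\supset$. For a formula $G$, $\mathrm{Sl}(G)$ and $\mathrm{Sr}(G)$ are the smallest subsets of the subformulas of $G$ with: $G\in\mathrm{Sr}(G)$; $A\land B$ or $A\lor B$ in $\mathrm{Sl}(G)$ (resp. $\mathrm{Sr}(G)$) implies $A,B$ in $\mathrm{Sl}(G)$ (resp. $\mathrm{Sr}(G)$); $A\supset B\in\mathrm{Sl}(G)$ implies $B\in\mathrm{Sl}(G)$, $A\in\mathrm{Sr}(G)$; $A\supset B\in\mathrm{Sr}(G)$ implies $B\in\mathrm{Sr}(G)$, $A\in\mathrm{Sl}(G)$. $\mathrm{Cl}(\Gamma)$ is the smallest set containing $\Gamma$ such that if $X,Y\in\mathrm{Cl}(\Gamma)$ and $A$ is any formula then $X\land Y,A\lor X,X\lor A,A\supset X\in\mathrm{Cl}(\Gamma)$. Commas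 denote union. $\mathbf{GBU}(G)$: sequents regular $\Psi\Rightarrow_g A$ and irregular $\Psi\rightarrow_g A$ with $\Psi\subseteq\mathrm{Sl}(G)$, $A\in\mathrm{Sr}(G)$ (all sequents in rules satisfy this). Rules ($k\in\{1,2\}$): axioms $A,\Psi\Rightarrow_g A$, $\bot,\Psi\Rightarrow_g C$, $A,\Psi\rightarrow_g A$; $L\land$: $A,B,\Psi\Rightarrow_g C/A\land B,\Psi\Rightarrow_g C$; $R\land$: $\Psi\Rightarrow_g A$, $\Psi\Rightarrow_g B/\Psi\Rightarrow_g A\land B$ and likewise with $\rightarrow_g$ throughout; $L\lor$: $A,\Psi\Rightarrow_g C$, $B,\Psi\Rightarrow_g C/A\lor B,\Psi\Rightarrow_g C$; $R\lor_k$: $\Psi\rightarrow_g C_k/\Psi\Rightarrow_g C_1\lor C_2$ and $\Psi\rightarrow_g C_k/\Psi\rightarrow_g C_1\lor C_2$; $L\supset$: $A\supset B,\Psi\rightarrow_g A$, $B,\Psi\Rightarrow_g C/A\supset B,\Psi\Rightarrow_g C$; $\supset R_\in$: $\Psi\Rightarrow_g B/\Psi\Rightarrow_g A\supset B$ and $\Psi\rightarrow_g B/\Psi\rightarrow_g A\supset B$, if $A\in\mathrm{Cl}(\Psi)$; $\supset R_{\notin}$: $A,\Psi\Rightarrow_g B/\Psi\Rightarrow_g A\supset B$ and $A,\Psi\Rightarrow_g B/\Psi\rightarrow_g A\supset B$, if $A\notin\mathrm{Cl}(\Psi)$. -}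

module Defs where

open import Data.Nat using (ℕ; zero; suc; _+_; _<_)
open import Data.Nat.Properties using (suc-injective)
open import Data.List using (List; []; _∷_; length; map; deduplicate)
open import Data.Nat.ListAction using (sum)
open import Data.List.Membership.Propositional using (_∈_; _∉_)
open import Data.List.Relation.Unary.All using (All)
open import Data.List.Relation.Unary.Unique.Propositional using (Unique)
open import Data.Product using (Σ; _×_; _,_)
open import Data.Sum using (_⊎_)
open import Relation.Nullary using (¬_; Dec; yes; no)
open import Relation.Binary.PropositionalEquality using (_≡_; refl; cong)
open import Function.Bundles using (_⇔_)

infixr 6 _∧_
infixr 5 _∨_
infixr 4 _⊃_

data Fm : Set where
  var : ℕ → Fm
  ⊥′  : Fm
  _∧_ : Fm → Fm → Fm
  _∨_ : Fm → Fm → Fm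
  _⊃_ : Fm → Fm → Fm

-- decidable equality on formulas (needed to read a list of formulas as a set)
private
  var-inj : ∀ {m n} → var m ≡ var n → m ≡ n
  var-inj refl = refl

_≟F_ : (A B : Fm) → Dec (A ≡ B)
var m ≟F var n with m Data.Nat.≟ n
... | yes refl = yes refl
... | no ne = no λ e → ne (var-inj e)
var _ ≟F ⊥′ = no λ ()
var _ ≟F (_ ∧ _) = no λ ()
var _ ≟F (_ ∨ _) = no λ ()
var _ ≟F (_ ⊃ _) = no λ ()
⊥′ ≟F var _ = no λ ()
⊥′ ≟F ⊥′ = yes refl
⊥′ ≟F (_ ∧ _) = no λ ()
⊥′ ≟F (_ ∨ _) = no λ ()
⊥′ ≟F (_ ⊃ _) = no λ ()
(_ ∧ _) ≟F var _ = no λ ()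
(_ ∧ _) ≟F ⊥′ = no λ ()
(A ∧ B) ≟F (C ∧ D) with A ≟F C | B ≟F D
... | yes refl | yes refl = yes refl
... | no ne | _ = no λ { refl → ne refl }
... | yes _ | no ne = no λ { refl → ne refl }
(_ ∧ _) ≟F (_ ∨ _) = no λ ()
(_ ∧ _) ≟F (_ ⊃ _) = no λ ()
(_ ∨ _) ≟F var _ = no λ ()
(_ ∨ _) ≟F ⊥′ = no λ ()
(_ ∨ _) ≟F (_ ∧ _) = no λ ()
(A ∨ B) ≟F (C ∨ D) with A ≟F C | B ≟F D
... | yes refl | yes refl = yes refl
... | no ne | _ = no λ { refl → ne refl }
... | yes _ | no ne = no λ { refl → ne refl }
(_ ∨ _) ≟F (_ ⊃ _) = no λ ()
(_ ⊃ _) ≟F var _ = no λ ()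
(_ ⊃ _) ≟F ⊥′ = no λ ()
(_ ⊃ _) ≟F (_ ∧ _) = no λ ()
(_ ⊃ _) ≟F (_ ∨ _) = no λ ()
(A ⊃ B) ≟F (C ⊃ D) with A ≟F C | B ≟F D
... | yes refl | yes refl = yes refl
... | no ne | _ = no λ { refl → ne refl }
... | yes _ | no ne = no λ { refl → ne refl }

mutual
  data Sr (G : Fm) : Fm → Set where
    sr-G   : Sr G G
    sr-∧ˡ  : ∀ {A B} → Sr G (A ∧ B) → Sr G A
    sr-∧ʳ  : ∀ {A B} → Sr G (A ∧ B) → Sr G B
    sr-∨ˡ  : ∀ {A B} → Sr G (A ∨ B) → Sr G A
    sr-∨ʳ  : ∀ {A B} → Sr G (A ∨ B) → Sr G B
    sr-⊃ʳ  : ∀ {A B} → Sr G (A ⊃ B) → Sr G B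
    sl-⊃ˡ  : ∀ {A B} → Sl G (A ⊃ B) → Sr G A

  data Sl (G : Fm) : Fm → Set where
    sl-∧ˡ  : ∀ {A B} → Sl G (A ∧ B) → Sl G A
    sl-∧ʳ  : ∀ {A B} → Sl G (A ∧ B) → Sl G B
    sl-∨ˡ  : ∀ {A B} → Sl G (A ∨ B) → Sl G A
    sl-∨ʳ  : ∀ {A B} → Sl G (A ∨ B) → Sl G B
    sl-⊃ʳ  : ∀ {A B} → Sl G (A ⊃ B) → Sl G B
    sr-⊃ˡ  : ∀ {A B} → Sr G (A ⊃ B) → Sl G A

data Cl (Γ : List Fm) : Fm → Set where
  cl-∈  : ∀ {X} → X ∈ Γ → Cl Γ X
  cl-∧  : ∀ {X Y} → Cl Γ X → Cl Γ Y → Cl Γ (X ∧ Y)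
  cl-∨ˡ : ∀ {X} A → Cl Γ X → Cl Γ (A ∨ X)
  cl-∨ʳ : ∀ {X} A → Cl Γ X → Cl Γ (X ∨ A)
  cl-⊃  : ∀ {X} A → Cl Γ X → Cl Γ (A ⊃ X)

-- The antecedent Ψ is a finite SET of formulas, represented by
-- a list read up to membership (order and repetitions are irrelevant for
-- everything below).

data Kind : Set where
  reg irr : Kind

record Seq : Set where
  constructor _∣_∣_
  field
    lhs  : List Fm
    kind : Kind
    rhs  : Fm
open Seq public

WF : Fm → Seq → Set
WF G τ = All (Sl G) (lhs τ) × Sr G (rhs τ)

data RuleInst : List Seq → Seq → Set where
  ax-id  : ∀ {A Ψ} → RuleInst [] ((A ∷ Ψ) ∣ reg ∣ A)
  ax-⊥   : ∀ {Ψ C} → RuleInst [] ((⊥′ ∷ Ψ) ∣ reg ∣ C)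
  ax-irr : ∀ {A Ψ} → RuleInst [] ((A ∷ Ψ) ∣ irr ∣ A)
  L∧     : ∀ {A B Ψ C} → (A ∧ B) ∉ Ψ →
           RuleInst (((A ∷ B ∷ Ψ) ∣ reg ∣ C) ∷ []) (((A ∧ B) ∷ Ψ) ∣ reg ∣ C)
  R∧     : ∀ {Ψ k A B} →
           RuleInst ((Ψ ∣ k ∣ A) ∷ (Ψ ∣ k ∣ B) ∷ []) (Ψ ∣ k ∣ (A ∧ B))
  L∨     : ∀ {A B Ψ C} → (A ∨ B) ∉ Ψ →
           RuleInst (((A ∷ Ψ) ∣ reg ∣ C) ∷ ((B ∷ Ψ) ∣ reg ∣ C) ∷ [])
                    (((A ∨ B) ∷ Ψ) ∣ reg ∣ C)
  R∨₁    : ∀ {Ψ k C₁ C₂} →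
           RuleInst ((Ψ ∣ irr ∣ C₁) ∷ []) (Ψ ∣ k ∣ (C₁ ∨ C₂))
  R∨₂    : ∀ {Ψ k C₁ C₂} →
           RuleInst ((Ψ ∣ irr ∣ C₂) ∷ []) (Ψ ∣ k ∣ (C₁ ∨ C₂))
  L⊃     : ∀ {A B Ψ C} → (A ⊃ B) ∉ Ψ →
           RuleInst ((((A ⊃ B) ∷ Ψ) ∣ irr ∣ A) ∷ ((B ∷ Ψ) ∣ reg ∣ C) ∷ [])
                    (((A ⊃ B) ∷ Ψ) ∣ reg ∣ C)
  ⊃R∈    : ∀ {Ψ k A B} → Cl Ψ A →
           RuleInst ((Ψ ∣ k ∣ B) ∷ []) (Ψ ∣ k ∣ (A ⊃ B))
  ⊃R∉    : ∀ {Ψ k A B} → ¬ Cl Ψ A →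
           RuleInst (((A ∷ Ψ) ∣ reg ∣ B) ∷ []) (Ψ ∣ k ∣ (A ⊃ B))

size : Fm → ℕ
size (var _) = 0
size ⊥′      = 1
size (A ∧ B) = suc (size A + size B)
size (A ∨ B) = suc (size A + size B)
size (A ⊃ B) = suc (size A + size B)

∣_∣ˢ : Seq → ℕ
∣ τ ∣ˢ = sum (map size (deduplicate _≟F_ (lhs τ))) + size (rhs τ)

tp : Seq → ℕ
tp τ with kind τ
... | reg = 1
... | irr = 0

HasCard : (Fm → Set) → ℕ → Set
HasCard P n = Σ (List Fm) λ xs → Unique xs × (∀ X → (X ∈ xs) ⇔ P X) × length xs ≡ n

SlMinusCl : Fm → List Fm → Fm → Set
SlMinusCl G Ψ X = Sl G X × ¬ Cl Ψ X

Triple : Set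
Triple = ℕ × ℕ × ℕ

_≺_ : Triple → Triple → Set
(a , b , c) ≺ (a′ , b′ , c′) =
  a < a′ ⊎ (a ≡ a′ × (b < b′ ⊎ (b ≡ b′ × c < c′)))

_⪯_ : Triple → Triple → Set
t ⪯ t′ = t ≺ t′ ⊎ t ≡ t′

-- Wg(τ) given n = |Sl(G) ∖ Cl(lhs τ)|
Wg : ℕ → Seq → Triple
Wg n τ = n , tp τ , ∣ τ ∣ˢ

-- A rule either closes off a new formula of Sl(G) — only ⊃R∉ does, adding
-- an A ∈ Sl(G) ∖ Cl(Ψ) to the antecedent — or it keeps Sl(G) ∖ Cl(Ψ) from
-- growing, because every antecedent formula of the conclusion lies in the
-- closure of the premise's antecedent (the principal formula of a left rule
-- is rebuilt from its components by the clauses of Cl).  In the second case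
-- either a regular sequent becomes irregular, or the premise carries fewer
-- logical symbols: a left rule replaces the principal formula, which does
-- not occur in Ψ, by strictly smaller components, and a right rule shrinks
-- the succedent.
module Submission where

open import Defs
open import Data.Nat using (ℕ; zero; suc; _+_; _≤_; _<_; z≤n; s≤s)
open import Data.Nat.Properties
  using (≤-refl; ≤-trans; m≤m+n; m≤n+m; +-assoc; +-monoʳ-≤; +-monoʳ-<; +-monoˡ-<;
         m≤n⇒m<n∨m≡n; module ≤-Reasoning)
open import Data.Nat.ListAction using (sum)
open import Data.Bool using (true; false)
open import Data.List using (List; []; _∷_; length; map; filter; deduplicate)
open import Data.List.Properties using (filter-all)
open import Data.List.Membership.Propositional using (_∈_; _∉_)
open import Data.List.Membership.Propositional.Properties using (∈-deduplicate⁻)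
open import Data.List.Relation.Binary.Subset.Propositional using (_⊆_)
open import Data.List.Relation.Unary.Any using (here; there)
open import Data.List.Relation.Unary.All using (All; []; _∷_; tabulate)
open import Data.List.Relation.Unary.AllPairs using ([]; _∷_)
open import Data.List.Relation.Unary.Unique.Propositional using (Unique)
import Data.List.Fresh as Fresh
import Data.List.Fresh.Relation.Unary.Any as FreshAny
import Data.List.Fresh.Membership.Setoid as FreshMembership
import Data.List.Fresh.Membership.Setoid.Properties as FreshMembershipProperties
open import Data.Product using (_×_; _,_)
open import Data.Product.Relation.Binary.Lex.Strict using (×-Lex)
open import Data.Sum using (inj₁; inj₂)
open import Function using (id; _∘_)
open import Function.Bundles using (Equivalence; _⇔_)
open import Relation.Nullary using (¬_; ¬?; does)
open import Relation.Unary using (Pred; Decidable)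
open import Relation.Binary.PropositionalEquality using (_≡_; _≢_; refl; cong; subst₂; setoid)

-- A HasCard witness is a duplicate-free list, i.e. a fresh list for _≢_, so
-- the counting lemmas for fresh lists apply to it.
module _ where
  open FreshMembership (setoid Fm) renaming (_∈_ to _∈#_)
  open FreshMembershipProperties (setoid Fm) using (injection; strict-injection)

  private
    length-fromList : ∀ {xs : List Fm} (u : Unique xs) →
                      Fresh.length (Fresh.fromList u) ≡ length xs
    length-fromList []      = refl
    length-fromList (_ ∷ u) = cong suc (length-fromList u)

    ∈-fromList⁺ : ∀ {x} {xs : List Fm} (u : Unique xs) → x ∈ xs → x ∈# Fresh.fromList u
    ∈-fromList⁺ (_ ∷ u) (here eq)  = FreshAny.here eq
    ∈-fromList⁺ (_ ∷ u) (there x∈) = FreshAny.there (∈-fromList⁺ u x∈)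

    ∈-fromList⁻ : ∀ {x} {xs : List Fm} (u : Unique xs) → x ∈# Fresh.fromList u → x ∈ xs
    ∈-fromList⁻ (_ ∷ u) (FreshAny.here eq)  = here eq
    ∈-fromList⁻ (_ ∷ u) (FreshAny.there x∈) = there (∈-fromList⁻ u x∈)

    fromList-mono : ∀ {P Q : Fm → Set} {xs ys : List Fm} (uxs : Unique xs) (uys : Unique ys) →
            (∀ X → (X ∈ xs) ⇔ P X) → (∀ X → (X ∈ ys) ⇔ Q X) → (∀ {X} → P X → Q X) →
            ∀ {X} → X ∈# Fresh.fromList uxs → X ∈# Fresh.fromList uys
    fromList-mono uxs uys xs⇔P ys⇔Q P⇒Q {X} =
      ∈-fromList⁺ uys ∘ Equivalence.from (ys⇔Q X) ∘ P⇒Q ∘ Equivalence.to (xs⇔P X) ∘ ∈-fromList⁻ uxs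

  HasCard-mono : ∀ {P Q : Fm → Set} {m n} → HasCard P m → HasCard Q n →
                 (∀ {X} → P X → Q X) → m ≤ n
  HasCard-mono (xs , uxs , xs⇔P , refl) (ys , uys , ys⇔Q , refl) P⇒Q =
    subst₂ _≤_ (length-fromList uxs) (length-fromList uys)
      (injection id (fromList-mono uxs uys xs⇔P ys⇔Q P⇒Q))

  HasCard-mono-< : ∀ {P Q : Fm → Set} {m n} → HasCard P m → HasCard Q n →
                   (∀ {X} → P X → Q X) → ∀ {X} → Q X → ¬ P X → m < n
  HasCard-mono-< (xs , uxs , xs⇔P , refl) (ys , uys , ys⇔Q , refl) P⇒Q {X} QX ¬PX =
    subst₂ _<_ (length-fromList uxs) (length-fromList uys)
      (strict-injection id (fromList-mono uxs uys xs⇔P ys⇔Q P⇒Q)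
        (X , ∈-fromList⁺ uys (Equivalence.from (ys⇔Q X) QX)
           , ¬PX ∘ Equivalence.to (xs⇔P X) ∘ ∈-fromList⁻ uxs))

_⊆Cl_ : List Fm → List Fm → Set
Γ ⊆Cl Δ = ∀ {X} → X ∈ Γ → Cl Δ X

⊆⇒⊆Cl : ∀ {Γ Δ} → Γ ⊆ Δ → Γ ⊆Cl Δ
⊆⇒⊆Cl Γ⊆Δ = cl-∈ ∘ Γ⊆Δ

∷-⊆Cl : ∀ {X Γ Δ} → Cl Δ X → Γ ⊆Cl Δ → (X ∷ Γ) ⊆Cl Δ
∷-⊆Cl clX Γ⊆Δ (here refl) = clX
∷-⊆Cl clX Γ⊆Δ (there X∈)  = Γ⊆Δ X∈

Cl-mono : ∀ {Γ Δ X} → Γ ⊆Cl Δ → Cl Γ X → Cl Δ X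
Cl-mono Γ⊆Δ (cl-∈ X∈)   = Γ⊆Δ X∈
Cl-mono Γ⊆Δ (cl-∧ c d)  = cl-∧ (Cl-mono Γ⊆Δ c) (Cl-mono Γ⊆Δ d)
Cl-mono Γ⊆Δ (cl-∨ˡ A c) = cl-∨ˡ A (Cl-mono Γ⊆Δ c)
Cl-mono Γ⊆Δ (cl-∨ʳ A c) = cl-∨ʳ A (Cl-mono Γ⊆Δ c)
Cl-mono Γ⊆Δ (cl-⊃ A c)  = cl-⊃ A (Cl-mono Γ⊆Δ c)

SlMinusCl-anti : ∀ {G Γ Δ X} → Γ ⊆Cl Δ → SlMinusCl G Δ X → SlMinusCl G Γ X
SlMinusCl-anti Γ⊆Δ (slX , ¬clX) = slX , ¬clX ∘ Cl-mono Γ⊆Δ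

conclusion-⊆Cl-premise : ∀ {ps τ τ′} → RuleInst ps τ → τ′ ∈ ps → lhs τ ⊆Cl lhs τ′
conclusion-⊆Cl-premise (L∧ _) (here refl) =
  ∷-⊆Cl (cl-∧ (cl-∈ (here refl)) (cl-∈ (there (here refl)))) (⊆⇒⊆Cl (there ∘ there))
conclusion-⊆Cl-premise (L∨ {A} {B} _) (here refl) =
  ∷-⊆Cl (cl-∨ʳ B (cl-∈ (here refl))) (⊆⇒⊆Cl there)
conclusion-⊆Cl-premise (L∨ {A} {B} _) (there (here refl)) =
  ∷-⊆Cl (cl-∨ˡ A (cl-∈ (here refl))) (⊆⇒⊆Cl there)
conclusion-⊆Cl-premise (L⊃ {A} _) (there (here refl)) =
  ∷-⊆Cl (cl-⊃ A (cl-∈ (here refl))) (⊆⇒⊆Cl there)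
conclusion-⊆Cl-premise (⊃R∉ _) (here refl)         = ⊆⇒⊆Cl there
conclusion-⊆Cl-premise (L⊃ _)  (here refl)         = cl-∈
conclusion-⊆Cl-premise R∧      (here refl)         = cl-∈
conclusion-⊆Cl-premise R∧      (there (here refl)) = cl-∈
conclusion-⊆Cl-premise R∨₁     (here refl)         = cl-∈
conclusion-⊆Cl-premise R∨₂     (here refl)         = cl-∈
conclusion-⊆Cl-premise (⊃R∈ _) (here refl)         = cl-∈

sum-filter-≤ : ∀ {a p} {A : Set a} {P : Pred A p} (f : A → ℕ) (P? : Decidable P) xs →
               sum (map f (filter P? xs)) ≤ sum (map f xs)
sum-filter-≤ f P? []       = z≤n
sum-filter-≤ f P? (x ∷ xs) with does (P? x)
... | true  = +-monoʳ-≤ (f x) (sum-filter-≤ f P? xs)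
... | false = ≤-trans (sum-filter-≤ f P? xs) (m≤n+m _ (f x))

sizeSet : List Fm → ℕ
sizeSet Ψ = sum (map size (deduplicate _≟F_ Ψ))

sizeSet-∷-≤ : ∀ X Ψ → sizeSet (X ∷ Ψ) ≤ size X + sizeSet Ψ
sizeSet-∷-≤ X Ψ = +-monoʳ-≤ (size X) (sum-filter-≤ size (¬? ∘ (X ≟F_)) (deduplicate _≟F_ Ψ))

sizeSet-∷∷-≤ : ∀ X Y Ψ → sizeSet (X ∷ Y ∷ Ψ) ≤ (size X + size Y) + sizeSet Ψ
sizeSet-∷∷-≤ X Y Ψ = begin
  sizeSet (X ∷ Y ∷ Ψ)            ≤⟨ sizeSet-∷-≤ X (Y ∷ Ψ) ⟩
  size X + sizeSet (Y ∷ Ψ)       ≤⟨ +-monoʳ-≤ (size X) (sizeSet-∷-≤ Y Ψ) ⟩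
  size X + (size Y + sizeSet Ψ)  ≡⟨ +-assoc (size X) (size Y) (sizeSet Ψ) ⟨
  (size X + size Y) + sizeSet Ψ  ∎
  where open ≤-Reasoning

sizeSet-∷-∉ : ∀ {X Ψ} → X ∉ Ψ → sizeSet (X ∷ Ψ) ≡ size X + sizeSet Ψ
sizeSet-∷-∉ {X} {Ψ} X∉Ψ =
  cong (λ xs → size X + sum (map size xs)) (filter-all (¬? ∘ (X ≟F_)) (tabulate X≢))
  where
  X≢ : ∀ {Y} → Y ∈ deduplicate _≟F_ Ψ → X ≢ Y
  X≢ Y∈ refl = X∉Ψ (∈-deduplicate⁻ _≟F_ Ψ Y∈)

sizeSet-principal-< : ∀ {X Ψ} Φ k → X ∉ Ψ → sizeSet Φ ≤ k + sizeSet Ψ → k < size X →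
                      sizeSet Φ < sizeSet (X ∷ Ψ)
sizeSet-principal-< {X} {Ψ} Φ k X∉Ψ Φ≤ k<X = begin-strict
  sizeSet Φ           ≤⟨ Φ≤ ⟩
  k + sizeSet Ψ       <⟨ +-monoˡ-< (sizeSet Ψ) k<X ⟩
  size X + sizeSet Ψ  ≡⟨ sizeSet-∷-∉ X∉Ψ ⟨
  sizeSet (X ∷ Ψ)     ∎
  where open ≤-Reasoning

size-<ˡ : ∀ A B → size A < suc (size A + size B)
size-<ˡ A B = s≤s (m≤m+n (size A) (size B))

size-<ʳ : ∀ A B → size B < suc (size A + size B)
size-<ʳ A B = s≤s (m≤n+m (size B) (size A))

record _⊏_ (τ′ τ : Seq) : Set where
  constructor lex
  field tp-size-< : ×-Lex _≡_ _<_ _<_ (tp τ′ , ∣ τ′ ∣ˢ) (tp τ , ∣ τ ∣ˢ)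

irr⊏reg : ∀ {Ψ′ Ψ A′ A} → (Ψ′ ∣ irr ∣ A′) ⊏ (Ψ ∣ reg ∣ A)
irr⊏reg = lex (inj₁ (s≤s z≤n))

⊏-rhs : ∀ {Ψ k A′ A} → size A′ < size A → (Ψ ∣ k ∣ A′) ⊏ (Ψ ∣ k ∣ A)
⊏-rhs {Ψ} A′<A = lex (inj₂ (refl , +-monoʳ-< (sizeSet Ψ) A′<A))

irr-⊏-rhs : ∀ {Ψ k A′ A} → size A′ < size A → (Ψ ∣ irr ∣ A′) ⊏ (Ψ ∣ k ∣ A)
irr-⊏-rhs {k = reg} _    = irr⊏reg
irr-⊏-rhs {k = irr} A′<A = ⊏-rhs A′<A

⊏-lhs : ∀ {Ψ′ Ψ C} → sizeSet Ψ′ < sizeSet Ψ → (Ψ′ ∣ reg ∣ C) ⊏ (Ψ ∣ reg ∣ C)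
⊏-lhs {C = C} Ψ′<Ψ = lex (inj₂ (refl , +-monoˡ-< (size C) Ψ′<Ψ))

data Progress (G : Fm) (τ′ τ : Seq) : Set where
  closes  : ∀ {X} → Sl G X → ¬ Cl (lhs τ) X → Cl (lhs τ′) X → Progress G τ′ τ
  lighter : τ′ ⊏ τ → Progress G τ′ τ

premise-progress : ∀ {G ps τ τ′} → RuleInst ps τ → All (WF G) ps → τ′ ∈ ps → Progress G τ′ τ
premise-progress (L∧ {A} {B} {Ψ} A∧B∉Ψ) _ (here refl) =
  lighter (⊏-lhs (sizeSet-principal-< (A ∷ B ∷ Ψ) (size A + size B) A∧B∉Ψ
                                       (sizeSet-∷∷-≤ A B Ψ) ≤-refl))
premise-progress (R∧ {A = A} {B}) _ (here refl)         = lighter (⊏-rhs (size-<ˡ A B))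
premise-progress (R∧ {A = A} {B}) _ (there (here refl)) = lighter (⊏-rhs (size-<ʳ A B))
premise-progress (L∨ {A} {B} {Ψ} A∨B∉Ψ) _ (here refl) =
  lighter (⊏-lhs (sizeSet-principal-< (A ∷ Ψ) (size A) A∨B∉Ψ
                                       (sizeSet-∷-≤ A Ψ) (size-<ˡ A B)))
premise-progress (L∨ {A} {B} {Ψ} A∨B∉Ψ) _ (there (here refl)) =
  lighter (⊏-lhs (sizeSet-principal-< (B ∷ Ψ) (size B) A∨B∉Ψ
                                       (sizeSet-∷-≤ B Ψ) (size-<ʳ A B)))
premise-progress (R∨₁ {C₁ = C₁} {C₂}) _ (here refl) = lighter (irr-⊏-rhs (size-<ˡ C₁ C₂))
premise-progress (R∨₂ {C₁ = C₁} {C₂}) _ (here refl) = lighter (irr-⊏-rhs (size-<ʳ C₁ C₂))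
premise-progress (L⊃ _) _ (here refl) = lighter irr⊏reg
premise-progress (L⊃ {A} {B} {Ψ} A⊃B∉Ψ) _ (there (here refl)) =
  lighter (⊏-lhs (sizeSet-principal-< (B ∷ Ψ) (size B) A⊃B∉Ψ
                                       (sizeSet-∷-≤ B Ψ) (size-<ʳ A B)))
premise-progress (⊃R∈ {A = A} {B} _) _ (here refl) = lighter (⊏-rhs (size-<ʳ A B))
premise-progress (⊃R∉ ¬clA) ((slA ∷ _ , _) ∷ []) (here refl) = closes slA ¬clA (cl-∈ (here refl))

origin-⪯ : ∀ t → (0 , 0 , 0) ⪯ t
origin-⪯ (suc a , b     , c)     = inj₁ (inj₁ (s≤s z≤n))
origin-⪯ (zero  , suc b , c)     = inj₁ (inj₂ (refl , inj₁ (s≤s z≤n)))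
origin-⪯ (zero  , zero  , suc c) = inj₁ (inj₂ (refl , inj₂ (refl , s≤s z≤n)))
origin-⪯ (zero  , zero  , zero)  = inj₂ refl

Wg-≺ : ∀ {n′ n τ′ τ} → n′ ≤ n → τ′ ⊏ τ → Wg n′ τ′ ≺ Wg n τ
Wg-≺ n′≤n (lex τ′<τ) with m≤n⇒m<n∨m≡n n′≤n
... | inj₁ n′<n = inj₁ n′<n
... | inj₂ refl = inj₂ (refl , τ′<τ)

lemma5p3 : (G : Fm) (ps : List Seq) (τ τ′ : Seq) →
    RuleInst ps τ → WF G τ → All (WF G) ps → τ′ ∈ ps →
    (n n′ : ℕ) → HasCard (SlMinusCl G (lhs τ)) n → HasCard (SlMinusCl G (lhs τ′)) n′ →
    ((0 , 0 , 0) ⪯ Wg n′ τ′) × (Wg n′ τ′ ≺ Wg n τ)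
lemma5p3 G ps τ τ′ rule _ wfs τ′∈ps n n′ card card′ = origin-⪯ (Wg n′ τ′) , descent
  where
  unclosed⊆ : ∀ {X} → SlMinusCl G (lhs τ′) X → SlMinusCl G (lhs τ) X
  unclosed⊆ = SlMinusCl-anti (conclusion-⊆Cl-premise rule τ′∈ps)

  descent : Wg n′ τ′ ≺ Wg n τ
  descent with premise-progress rule wfs τ′∈ps
  ... | closes slX ¬clX clX′ =
    inj₁ (HasCard-mono-< card′ card unclosed⊆ (slX , ¬clX) (λ (_ , ¬clX′) → ¬clX′ clX′))
  ... | lighter τ′⊏τ = Wg-≺ (HasCard-mono card′ card unclosed⊆) τ′⊏τ
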